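{- Let $K=\{S_1,\dots,S_k\}$ be a valid set system in a finite measure space $(\Omega,\mu)$, and let $I_1,\dots,I_m$ be a partition of $K$ into (nonempty) set systems. Then, for the set elimination games in $K,I_1,\dots,I_m$ all driven by the same sequence $\omega_1,\omega_2,\dots$, we have (whenever the winners are defined, in particular with probability $1$) $$\mathrm{win}(K)\in\{\mathrm{win}(I_1),\dots,\mathrm{win}(I_m)\}.$$
   Context: $(\Omega,\mu)$ is a finite measure space with $\mu(\Omega)>0$. A family $I$ of measurable subsets of $\Omega$ is a valid set system if $\mu(S)>0$ for every $S\in I$ and $\mu(S'\triangle S'')>0$ for all distinct $S',S''\in I$. Let $\omega_1,\omega_2,\dots$ be i.i.d. random elements of $\Omega$ with law $\mu/\mu(\Omega)$. The set elimination game in a valid set system $I$: $\mathcal{R}_0(I)=I$ and, for $n\ge1$, $\mathcal{R}_n(I)=\mathcal{R}_{n-1}(I)\setminus\{S\in\mathcal{R}_{n-1}(I):\omega_n\in S\}$ if some $S'\in\mathcal{R}_{n-1}(I)$ has $\omega_n\notin S'$, and $\mathcal{R}_n(I)=\mathcal{R}_{n-1}(I)$ otherwise. The winner $\mathrm{win}(I)$ is the unique element of $\bigcap_{n\ge0}\mathcal{R}_n(I)$ (undefined if this intersection has more than one element; it has exactly one element with probability $1$). -}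

module Defs where

open import Data.Nat using (ℕ; zero; suc)
open import Data.Fin using (Fin; zero; suc; _≟_)
open import Data.Bool using (Bool; true; false; _∧_; _∨_; not; if_then_else_)
open import Data.Product using (_×_)
open import Relation.Binary.PropositionalEquality using (_≡_)
open import Relation.Nullary.Decidable using (⌊_⌋)

anyFin : ∀ {k : ℕ} → (Fin k → Bool) → Bool
anyFin {zero}  f = false
anyFin {suc k} f = f zero ∨ anyFin (λ i → f (suc i))

-- A set system inside the ambient family S₁,…,S_k (S : Fin k → Ω → Bool,
-- membership ω ∈ S i is  S i ω ≡ true) is given by its indicator on indices.
SubSystem : ℕ → Set
SubSystem k = Fin k → Bool

-- The set elimination game. R S J ω n is the indicator of 𝓡ₙ(J).
-- The sequence is ω 0, ω 1, …  (ω n plays the role of ω_{n+1}).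
R : ∀ {Ω : Set} {k : ℕ} → (Fin k → Ω → Bool) → SubSystem k → (ℕ → Ω) → ℕ → SubSystem k
R S J ω zero = J
R S J ω (suc n) =
  let prev = R S J ω n
      x    = ω n
      kept = λ i → prev i ∧ not (S i x)
  in if anyFin kept then kept else prev

Survives : ∀ {Ω : Set} {k : ℕ} → (Fin k → Ω → Bool) → SubSystem k → (ℕ → Ω) → Fin k → Set
Survives S J ω i = ∀ n → R S J ω n i ≡ true

-- win(J) is defined and equals S i : ⋂ₙ 𝓡ₙ(J) = {S i}
IsWinner : ∀ {Ω : Set} {k : ℕ} → (Fin k → Ω → Bool) → SubSystem k → (ℕ → Ω) → Fin k → Set
IsWinner S J ω i = Survives S J ω i × (∀ j → Survives S J ω j → j ≡ i)

Whole : ∀ {k : ℕ} → SubSystem k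
Whole _ = true

Part : ∀ {k m : ℕ} → (Fin k → Fin m) → Fin m → SubSystem k
Part part j i = ⌊ part i ≟ j ⌋

{-# OPTIONS --safe #-}
-- Let w be the winner of the game in K and J the part containing w. By induction on n,
-- 𝓡ₙ(J) = J ∩ 𝓡ₙ(K): whenever the move ωₙ is played in K, some set of 𝓡ₙ(K) survives it,
-- namely w ∈ J, so it is also played in J and eliminates exactly the same sets there;
-- when it is skipped in K, every set of 𝓡ₙ(K), hence of 𝓡ₙ(J), contains ωₙ. Thus w survives
-- the game in J as well, and uniqueness of win(J) gives w = win(J).
module Submission where

open import Defs
open import Data.Nat using (ℕ; zero; suc)
open import Data.Fin using (Fin; zero; suc; _≟_)
open import Data.Bool using (Bool; true; false; _∧_; not)
open import Data.Bool.Properties using (∧-assoc; ∧-zeroʳ)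
open import Data.Product using (∃; _,_; proj₂)
open import Relation.Binary.PropositionalEquality
open import Relation.Nullary.Decidable using (isYes≗does; dec-true)

f≡true⇒anyFin≡true : ∀ {k} (f : Fin k → Bool) (i : Fin k) → f i ≡ true → anyFin f ≡ true
f≡true⇒anyFin≡true f zero    fi≡true rewrite fi≡true = refl
f≡true⇒anyFin≡true f (suc i) fi≡true with f zero
... | true  = refl
... | false = f≡true⇒anyFin≡true (λ j → f (suc j)) i fi≡true

anyFin≡false⇒f≡false : ∀ {k} (f : Fin k → Bool) (i : Fin k) → anyFin f ≡ false → f i ≡ false
anyFin≡false⇒f≡false f i any≡false with f i in fi
... | false = refl
... | true  = trans (sym (f≡true⇒anyFin≡true f i fi)) any≡false

f≡false⇒anyFin≡false : ∀ {k} (f : Fin k → Bool) → (∀ i → f i ≡ false) → anyFin f ≡ false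
f≡false⇒anyFin≡false {zero}  f f≡false = refl
f≡false⇒anyFin≡false {suc k} f f≡false
  rewrite f≡false zero = f≡false⇒anyFin≡false (λ j → f (suc j)) (λ j → f≡false (suc j))

_⊆_ : ∀ {k} → SubSystem k → SubSystem k → Set
J ⊆ J′ = ∀ i → J i ≡ true → J′ i ≡ true

module _ {Ω : Set} {k : ℕ} (S : Fin k → Ω → Bool) (ω : ℕ → Ω) where

  eliminated : SubSystem k → ℕ → SubSystem k
  eliminated J n i = R S J ω n i ∧ not (S i (ω n))

  R-suc-played : ∀ J n → anyFin (eliminated J n) ≡ true → R S J ω (suc n) ≡ eliminated J n
  R-suc-played J n played rewrite played = refl

  R-suc-skipped : ∀ J n → anyFin (eliminated J n) ≡ false → R S J ω (suc n) ≡ R S J ω n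
  R-suc-skipped J n skipped rewrite skipped = refl

  eliminated-restrict : ∀ {J J′} n → (∀ i → R S J ω n i ≡ J i ∧ R S J′ ω n i) →
                        ∀ i → eliminated J n i ≡ J i ∧ eliminated J′ n i
  eliminated-restrict {J} n R≡ i rewrite R≡ i = ∧-assoc (J i) _ _

  -- In the successor cases the `with` has already unfolded R S J′ ω (suc n) in the goal.
  R-restrict : ∀ {J J′ w} → J ⊆ J′ → J w ≡ true → Survives S J′ ω w →
               ∀ n i → R S J ω n i ≡ J i ∧ R S J′ ω n i
  R-restrict {J} J⊆J′ Jw sv zero i with J i in Ji
  ... | false = refl
  ... | true  = sym (J⊆J′ i Ji)
  R-restrict {J} {J′} {w} J⊆J′ Jw sv (suc n) i with anyFin (eliminated J′ n) in e
  ... | true  = begin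
      R S J ω (suc n) i           ≡⟨ cong-app (R-suc-played J n playedJ) i ⟩
      eliminated J n i            ≡⟨ eliminated-restrict n (R-restrict J⊆J′ Jw sv n) i ⟩
      J i ∧ eliminated J′ n i     ∎
    where
    open ≡-Reasoning
    playedJ : anyFin (eliminated J n) ≡ true
    playedJ = f≡true⇒anyFin≡true (eliminated J n) w (begin
      eliminated J n w           ≡⟨ eliminated-restrict n (R-restrict J⊆J′ Jw sv n) w ⟩
      J w ∧ eliminated J′ n w    ≡⟨ cong (_∧ eliminated J′ n w) Jw ⟩
      eliminated J′ n w          ≡⟨ cong-app (R-suc-played J′ n e) w ⟨
      R S J′ ω (suc n) w         ≡⟨ sv (suc n) ⟩
      true                       ∎)
  ... | false = begin
      R S J ω (suc n) i           ≡⟨ cong-app (R-suc-skipped J n skippedJ) i ⟩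
      R S J ω n i                 ≡⟨ R-restrict J⊆J′ Jw sv n i ⟩
      J i ∧ R S J′ ω n i          ∎
    where
    open ≡-Reasoning
    skippedJ : anyFin (eliminated J n) ≡ false
    skippedJ = f≡false⇒anyFin≡false (eliminated J n) λ j → begin
      eliminated J n j          ≡⟨ eliminated-restrict n (R-restrict J⊆J′ Jw sv n) j ⟩
      J j ∧ eliminated J′ n j   ≡⟨ cong (J j ∧_) (anyFin≡false⇒f≡false _ j e) ⟩
      J j ∧ false               ≡⟨ ∧-zeroʳ (J j) ⟩
      false                     ∎

  Survives-restrict : ∀ {J J′ w} → J ⊆ J′ → J w ≡ true → Survives S J′ ω w → Survives S J ω w
  Survives-restrict {J} {J′} {w} J⊆J′ Jw sv n = begin
    R S J ω n w          ≡⟨ R-restrict J⊆J′ Jw sv n w ⟩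
    J w ∧ R S J′ ω n w   ≡⟨ cong₂ _∧_ Jw (sv n) ⟩
    true                 ∎
    where open ≡-Reasoning

Part⊆Whole : ∀ {k m} (part : Fin k → Fin m) j → Part part j ⊆ Whole
Part⊆Whole part j i _ = refl

Part-self : ∀ {k m} (part : Fin k → Fin m) i → Part part (part i) i ≡ true
Part-self part i = trans (isYes≗does (part i ≟ part i)) (dec-true (part i ≟ part i) refl)

lemma1 : {Ω : Set} {k m : ℕ} (S : Fin k → Ω → Bool) (part : Fin k → Fin m) →
         (∀ j → ∃ λ i → part i ≡ j) →
         (ω : ℕ → Ω) (w : Fin k) → IsWinner S Whole ω w →
         (wI : Fin m → Fin k) → (∀ j → IsWinner S (Part part j) ω (wI j)) →
         ∃ λ j → w ≡ wI j
lemma1 S part _ ω w (w-survives , _) wI wI-wins =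
  part w , proj₂ (wI-wins (part w)) w w-survives-in-part
  where
  w-survives-in-part : Survives S (Part part (part w)) ω w
  w-survives-in-part =
    Survives-restrict S ω (Part⊆Whole part (part w)) (Part-self part w) w-survives
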